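{- Let $d,k\geqslant 1$ be integers and let $\mathcal X=\{\mathbf x_1,\ldots,\mathbf x_k\}\subseteq \mathsf{T}_d\cap\mathbb{Q}^d$. For an integer $q\geqslant 1$, let $h_q$ be the number of pairs $(i,j)$ with $1\leqslant i,j\leqslant k$ such that $q$ is the smallest positive integer with $q(\mathbf x_i-\mathbf x_j)\in\mathbb{Z}^d$. Then for every $q\in\mathbb{N}$ we have $h_q\leqslant k q^d$.
   Context: $\mathsf{T}_d=(\mathbb{R}/\mathbb{Z})^d$ is identified with the unit cube $[0,1)^d$. -}

module Defs where

open import Data.Nat as ℕ using (ℕ; suc; _≤_; _<_)
open import Data.Integer using (+_)
open import Data.Rational using (ℚ; _/_; _*_; _-_)
open ℚ using (denominatorℕ)
open import Data.Fin using (Fin; toℕ)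
open import Data.Fin.Properties using (all?)
open import Data.Product using (_×_; _,_)
open import Data.List using (List; length; filter; cartesianProduct; allFin)
open import Relation.Binary.PropositionalEquality using (_≡_)
open import Relation.Nullary using (¬_; Dec)
open import Relation.Nullary.Decidable using (_×-dec_; _→-dec_; ¬?)

IsInteger : ℚ → Set
IsInteger r = denominatorℕ r ≡ 1

isInteger? : (r : ℚ) → Dec (IsInteger r)
isInteger? r = denominatorℕ r ℕ.≟ 1

ℕtoℚ : ℕ → ℚ
ℕtoℚ m = (+ m) / 1

ScaledDiffIntegral : ∀ {d} → (Fin d → ℚ) → (Fin d → ℚ) → ℕ → Set
ScaledDiffIntegral x y m = ∀ l → IsInteger (ℕtoℚ m * (x l - y l))

scaledDiffIntegral? : ∀ {d} (x y : Fin d → ℚ) (m : ℕ) → Dec (ScaledDiffIntegral x y m)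
scaledDiffIntegral? x y m = all? (λ l → isInteger? (ℕtoℚ m * (x l - y l)))

IsOrder : ∀ {d} → (Fin d → ℚ) → (Fin d → ℚ) → ℕ → Set
IsOrder x y q =
  (1 ≤ q) × (ScaledDiffIntegral x y q
    × (∀ (m : Fin q) → 1 ≤ toℕ m → ¬ ScaledDiffIntegral x y (toℕ m)))

isOrder? : ∀ {d} (x y : Fin d → ℚ) (q : ℕ) → Dec (IsOrder x y q)
isOrder? x y q =
  (1 ℕ.≤? q) ×-dec (scaledDiffIntegral? x y q
    ×-dec all? (λ m → (1 ℕ.≤? toℕ m) →-dec ¬? (scaledDiffIntegral? x y (toℕ m))))

h : ∀ {d k} → (Fin k → Fin d → ℚ) → ℕ → ℕ
h {d} {k} x q =
  length (filter (λ { (i , j) → isOrder? (x i) (x j) q })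
                 (cartesianProduct (allFin k) (allFin k)))

-- Fix q ≥ 1 and i. Every pair (i , j) counted by h_q has q x_j ≡ q x_i (mod ℤ^d), and
-- q x_j ∈ [0,q)^d lies in one of the q^d unit cells ∏_l [c_l, c_l + 1), c ∈ {0,…,q−1}^d.
-- Two such points in the same cell differ by a vector of ℤ^d ∩ (−1,1)^d = {0}, so j is
-- determined by its cell and (i , j) ↦ (i , cell of q x_j) injects the counted pairs into
-- a set of size k q^d.
module Submission where

open import Defs
open import Data.Nat using (ℕ; zero; suc; _≤_; _*_; _^_; z≤n)
import Data.Nat.Properties as ℕ
open import Data.Nat.Coprimality using (1-coprimeTo) renaming (sym to coprime-sym)
open import Data.Integer as ℤ using (ℤ; +_; +[1+_])
import Data.Integer.Properties as ℤ
open import Data.Rational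
  using (ℚ; mkℚ; ↥_; 0ℚ; 1ℚ; _+_; _-_; Positive)
  renaming (_*_ to _*ℚ_; _≤_ to _≤ℚ_; _<_ to _<ℚ_)
open import Data.Rational.Properties
  using ( ≤-antisym; ≤-reflexive; <-irrefl; ≤-<-trans; _<?_; ≮⇒≥; drop-*<*; toℚᵘ-injective
        ; toℚᵘ-homo-+; +-monoˡ-<; +-mono-<-≤; neg-antimono-≤; *-zeroʳ; *-identityʳ
        ; *-monoˡ-≤-nonNeg; *-monoʳ-<-pos; *-cancelˡ-≤-pos; normalize-coprime )
import Data.Rational.Unnormalised as ℚᵘ
import Data.Rational.Unnormalised.Properties as ℚᵘ
open import Data.Rational.Solver using (module +-*-Solver)
open import Data.Fin using (Fin; zero; suc; toℕ; fromℕ; inject₁; combine)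
import Data.Fin.Properties as Fin
open import Data.List using (List; _∷_; length; filter; lookup; cartesianProduct; allFin)
open import Data.List.Properties using (filter-none)
open import Data.List.Membership.Propositional.Properties using (∈-lookup; ∈-filter⁻)
import Data.List.Relation.Unary.All as All
open import Data.List.Relation.Unary.AllPairs using (_∷_)
open import Data.List.Relation.Unary.Unique.Propositional using (Unique)
import Data.List.Relation.Unary.Unique.Propositional.Properties as Unique
open import Data.Product using (Σ; _×_; _,_; proj₁; proj₂)
open import Data.Empty using (⊥-elim)
open import Function using (Injective)
open import Relation.Binary.PropositionalEquality
open import Relation.Nullary using (yes; no)
open import Relation.Unary using (Pred; Decidable)
open import Level using (0ℓ)

-- Unlike ℕtoℚ m = + m / 1, this is a normal form by construction, so e.g. the
-- positivity of fromℤ +[1+ n ] is found by computation.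
fromℤ : ℤ → ℚ
fromℤ i = mkℚ i 0 (coprime-sym (1-coprimeTo _))

ℕtoℚ≡fromℤ : ∀ m → ℕtoℚ m ≡ fromℤ (+ m)
ℕtoℚ≡fromℤ m = normalize-coprime (coprime-sym (1-coprimeTo m))

isInteger⇒≡fromℤ↥ : ∀ r → IsInteger r → r ≡ fromℤ (↥ r)
isInteger⇒≡fromℤ↥ (mkℚ _ .0 _) refl = refl

fromℤ-+ : ∀ i j → fromℤ i + fromℤ j ≡ fromℤ (i ℤ.+ j)
fromℤ-+ i j = toℚᵘ-injective (ℚᵘ.≃-trans (toℚᵘ-homo-+ (fromℤ i) (fromℤ j))
  (ℚᵘ.*≡* (cong₂ ℤ._*_ (cong₂ ℤ._+_ (ℤ.*-identityʳ i) (ℤ.*-identityʳ j)) refl)))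

fromℤ-cancel-< : ∀ {i j} → fromℤ i <ℚ fromℤ j → i ℤ.< j
fromℤ-cancel-< {i} {j} i<j = subst₂ ℤ._<_ (ℤ.*-identityʳ i) (ℤ.*-identityʳ j) (drop-*<* i<j)

fromℤ-diff<1⇒≤ : ∀ i j → fromℤ i - fromℤ j <ℚ 1ℚ → i ℤ.≤ j
fromℤ-diff<1⇒≤ i j i-j<1 =
  subst (i ℤ.≤_) (ℤ.pred-suc j) (ℤ.i<j⇒i≤pred[j] (fromℤ-cancel-< i<j+1))
  where
  open +-*-Solver
  i<j+1 : fromℤ i <ℚ fromℤ (ℤ.suc j)
  i<j+1 = subst₂ _<ℚ_ (solve 2 (λ a b → (a :- b) :+ b := a) refl (fromℤ i) (fromℤ j))
                      (fromℤ-+ (+ 1) j)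
                      (+-monoˡ-< (fromℤ j) i-j<1)

isInteger-close⇒≡ : ∀ r s → IsInteger r → IsInteger s → r - s <ℚ 1ℚ → s - r <ℚ 1ℚ → r ≡ s
isInteger-close⇒≡ r s r∈ℤ s∈ℤ r-s<1 s-r<1 = begin
  r              ≡⟨ r≡ ⟩
  fromℤ (↥ r)    ≡⟨ cong fromℤ (ℤ.≤-antisym
                      (fromℤ-diff<1⇒≤ (↥ r) (↥ s) (subst₂ (λ a b → a - b <ℚ 1ℚ) r≡ s≡ r-s<1))
                      (fromℤ-diff<1⇒≤ (↥ s) (↥ r) (subst₂ (λ a b → a - b <ℚ 1ℚ) s≡ r≡ s-r<1))) ⟩
  fromℤ (↥ s)    ≡⟨ sym s≡ ⟩
  s              ∎
  where
  open ≡-Reasoning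
  r≡ = isInteger⇒≡fromℤ↥ r r∈ℤ
  s≡ = isInteger⇒≡fromℤ↥ s s∈ℤ

InUnitCell : ℚ → ℚ → Set
InUnitCell c r = c ≤ℚ r × r <ℚ c + 1ℚ

inUnitCell-diff<1 : ∀ {c r s} → InUnitCell c r → InUnitCell c s → r - s <ℚ 1ℚ
inUnitCell-diff<1 {c} {r} {s} (_ , r<c+1) (c≤s , _) =
  subst (r - s <ℚ_) (solve 1 (λ a → (a :+ con 1ℚ) :- a := con 1ℚ) refl c)
    (+-mono-<-≤ r<c+1 (neg-antimono-≤ c≤s))
  where open +-*-Solver

floorFin : ∀ m r → 0ℚ ≤ℚ r → r <ℚ fromℤ (+ m) → Σ (Fin m) λ c → InUnitCell (fromℤ (+ toℕ c)) r
floorFin zero r 0≤r r<0 = ⊥-elim (<-irrefl refl (≤-<-trans 0≤r r<0))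
floorFin (suc m) r 0≤r r<m+1 with r <? fromℤ (+ m)
... | yes r<m = let c , r∈c = floorFin m r 0≤r r<m in
  inject₁ c , subst (λ t → InUnitCell (fromℤ (+ t)) r) (sym (Fin.toℕ-inject₁ c)) r∈c
... | no r≮m = fromℕ m , subst (λ t → InUnitCell (fromℤ (+ t)) r) (sym (Fin.toℕ-fromℕ m))
  (≮⇒≥ r≮m , subst (r <ℚ_) (sym m+1≡) r<m+1)
  where
  m+1≡ : fromℤ (+ m) + 1ℚ ≡ fromℤ (+ suc m)
  m+1≡ = trans (fromℤ-+ (+ m) (+ 1)) (cong (λ t → fromℤ (+ t)) (ℕ.+-comm m 1))

*-cancelˡ-pos-≡ : ∀ r .{{_ : Positive r}} {p q} → r *ℚ p ≡ r *ℚ q → p ≡ q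
*-cancelˡ-pos-≡ r rp≡rq =
  ≤-antisym (*-cancelˡ-≤-pos r (≤-reflexive rp≡rq)) (*-cancelˡ-≤-pos r (≤-reflexive (sym rp≡rq)))

-- Q t − Q u and Q t − Q v are integers whose difference Q v − Q u lies in (−1, 1).
congruent-sameCell⇒≡ : ∀ Q .{{_ : Positive Q}} {t u v c} →
  IsInteger (Q *ℚ (t - u)) → IsInteger (Q *ℚ (t - v)) →
  InUnitCell c (Q *ℚ u) → InUnitCell c (Q *ℚ v) → u ≡ v
congruent-sameCell⇒≡ Q {t} {u} {v} A∈ℤ B∈ℤ u∈c v∈c = *-cancelˡ-pos-≡ Q (begin
  Q *ℚ u                  ≡⟨ split u ⟩
  Q *ℚ t - Q *ℚ (t - u)   ≡⟨ cong (λ a → Q *ℚ t - a) A≡B ⟩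
  Q *ℚ t - Q *ℚ (t - v)   ≡⟨ sym (split v) ⟩
  Q *ℚ v                  ∎)
  where
  open ≡-Reasoning
  open +-*-Solver
  split : ∀ w → Q *ℚ w ≡ Q *ℚ t - Q *ℚ (t - w)
  split w = solve 3 (λ q a b → q :* b := q :* a :- q :* (a :- b)) refl Q t w
  diff : ∀ w w′ → Q *ℚ (t - w) - Q *ℚ (t - w′) ≡ Q *ℚ w′ - Q *ℚ w
  diff w w′ = solve 4 (λ q a b b′ → q :* (a :- b) :- q :* (a :- b′) := q :* b′ :- q :* b)
                refl Q t w w′
  A≡B : Q *ℚ (t - u) ≡ Q *ℚ (t - v)
  A≡B = isInteger-close⇒≡ _ _ A∈ℤ B∈ℤ
    (subst (_<ℚ 1ℚ) (sym (diff u v)) (inUnitCell-diff<1 v∈c u∈c))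
    (subst (_<ℚ 1ℚ) (sym (diff v u)) (inUnitCell-diff<1 u∈c v∈c))

InUnitCube : ∀ {d} → (Fin d → ℚ) → Set
InUnitCube y = ∀ l → 0ℚ ≤ℚ y l × y l <ℚ 1ℚ

scaledFloor : ∀ {d} n (y : Fin d → ℚ) → InUnitCube y → ∀ l →
  Σ (Fin (suc n)) λ c → InUnitCell (fromℤ (+ toℕ c)) (fromℤ +[1+ n ] *ℚ y l)
scaledFloor n y y∈ l = floorFin (suc n) (Q *ℚ y l) 0≤Qy Qy<Q
  where
  Q = fromℤ +[1+ n ]
  0≤Qy : 0ℚ ≤ℚ Q *ℚ y l
  0≤Qy = subst (_≤ℚ Q *ℚ y l) (*-zeroʳ Q) (*-monoˡ-≤-nonNeg Q (proj₁ (y∈ l)))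
  Qy<Q : Q *ℚ y l <ℚ Q
  Qy<Q = subst (Q *ℚ y l <ℚ_) (*-identityʳ Q) (*-monoʳ-<-pos Q (proj₂ (y∈ l)))

gridCell : ∀ {d} n (y : Fin d → ℚ) → InUnitCube y → Fin d → Fin (suc n)
gridCell n y y∈ l = proj₁ (scaledFloor n y y∈ l)

congruent-sameGridCell⇒≡ : ∀ {d} n {y z w : Fin d → ℚ} (z∈ : InUnitCube z) (w∈ : InUnitCube w) →
  ScaledDiffIntegral y z (suc n) → ScaledDiffIntegral y w (suc n) →
  (∀ l → gridCell n z z∈ l ≡ gridCell n w w∈ l) → ∀ l → z l ≡ w l
congruent-sameGridCell⇒≡ n {y} {z} {w} z∈ w∈ yz yw same l =
  congruent-sameCell⇒≡ (fromℤ +[1+ n ]) {y l} (scaled (yz l)) (scaled (yw l))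
    (proj₂ (scaledFloor n z z∈ l))
    (subst (λ c → InUnitCell (fromℤ (+ toℕ c)) _) (sym (same l)) (proj₂ (scaledFloor n w w∈ l)))
  where
  scaled : ∀ {r} → IsInteger (ℕtoℚ (suc n) *ℚ r) → IsInteger (fromℤ +[1+ n ] *ℚ r)
  scaled = subst (λ Q → IsInteger (Q *ℚ _)) (ℕtoℚ≡fromℤ (suc n))

encode : ∀ {q d} → (Fin d → Fin q) → Fin (q ^ d)
encode {d = zero}  f = zero
encode {d = suc d} f = combine (f zero) (encode (λ l → f (suc l)))

encode-injective : ∀ {q d} {f g : Fin d → Fin q} → encode f ≡ encode g → ∀ l → f l ≡ g l
encode-injective {d = suc d} {f} {g} e zero    = Fin.combine-injectiveˡ (f zero) _ (g zero) _ e
encode-injective {d = suc d} {f} {g} e (suc l) =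
  encode-injective (Fin.combine-injectiveʳ (f zero) _ (g zero) _ e) l

unique-lookup-injective : ∀ {A : Set} {xs : List A} → Unique xs → Injective _≡_ _≡_ (lookup xs)
unique-lookup-injective {xs = _ ∷ _} _        {zero}  {zero}  _ = refl
unique-lookup-injective {xs = _ ∷ _} (x∉ ∷ _) {zero}  {suc j} e = ⊥-elim (All.lookup x∉ (∈-lookup j) e)
unique-lookup-injective {xs = _ ∷ _} (x∉ ∷ _) {suc i} {zero}  e = ⊥-elim (All.lookup x∉ (∈-lookup i) (sym e))
unique-lookup-injective {xs = _ ∷ _} (_ ∷ u)  {suc i} {suc j} e = cong suc (unique-lookup-injective u e)

length-filter≤ : ∀ {A : Set} {P : Pred A 0ℓ} (P? : Decidable P) {xs : List A} {N} → Unique xs →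
  (g : A → Fin N) → (∀ {a b} → P a → P b → g a ≡ g b → a ≡ b) → length (filter P? xs) ≤ N
length-filter≤ {P = P} P? {xs} xs! g g-inj =
  Fin.injective⇒≤ (λ e → unique-lookup-injective (Unique.filter⁺ P? xs!) (g-inj (holds _) (holds _) e))
  where
  holds : ∀ i → P (lookup (filter P? xs) i)
  holds i = proj₂ (∈-filter⁻ P? {xs = xs} (∈-lookup i))

lemma2p2 : (d k : ℕ) → 1 ≤ d → 1 ≤ k
    → (x : Fin k → Fin d → ℚ)
    → (∀ i l → (0ℚ ≤ℚ x i l) × (x i l <ℚ 1ℚ))
    → (∀ i j → (∀ l → x i l ≡ x j l) → i ≡ j)
    → (q : ℕ) → h x q ≤ k * q ^ d
lemma2p2 d k _ _ x _ _ zero =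
  ℕ.≤-trans (ℕ.≤-reflexive (cong length (filter-none _ (All.universal (λ { (_ , _) (() , _) }) pairs)))) z≤n
  where pairs = cartesianProduct (allFin k) (allFin k)
lemma2p2 d k _ _ x x∈ x-inj (suc n) =
  length-filter≤ _ (Unique.cartesianProduct⁺ (Unique.allFin⁺ k) (Unique.allFin⁺ k)) label
    (λ { {_ , _} {_ , _} (_ , ij , _) (_ , ij′ , _) → label-injective ij ij′ })
  where
  label : Fin k × Fin k → Fin (k * suc n ^ d)
  label (i , j) = combine i (encode (gridCell n (x j) (x∈ j)))
  label-injective : ∀ {i j i′ j′} → ScaledDiffIntegral (x i) (x j) (suc n) →
    ScaledDiffIntegral (x i′) (x j′) (suc n) → label (i , j) ≡ label (i′ , j′) → (i , j) ≡ (i′ , j′)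
  label-injective {i} {j} {i′} {j′} ij i′j′ e with refl ← Fin.combine-injectiveˡ i _ i′ _ e =
    cong (i ,_) (x-inj j j′ (congruent-sameGridCell⇒≡ n {x i} (x∈ j) (x∈ j′) ij i′j′
      (encode-injective (Fin.combine-injectiveʳ i _ i′ _ e))))
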